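{- Let $f$ be a quasi-polynomial of period $n$ with the gcd-property, and let $k$ be a positive integer. For a positive integer $d$ dividing $n$ and an integer $j$, let $\tilde f^{d}_j(t)$ denote the constituent of the quasi-polynomial $\tilde f^{d}$ for $t\equiv j\bmod d$. If $\gcd(j,n)=1$, then \[ \tilde f^{\gcd(k,n)}_j(t)=\tilde f^{\gcd(k,\operatorname{rad}(n))}_j(t). \]
   Context: A quasi-polynomial is a function $f:\mathbb{Z}\to\mathbb{C}$ for which there exist a positive integer $N$ (a period) and polynomials $f_1,\dots,f_N$ (constituents) with $f(t)=f_j(t)$ for $t\equiv j\bmod N$ (index $N$ for $t\equiv0$); the minimal period is the least period. A quasi-polynomial $f$ of period $n$ with constituents $f_1,\dots,f_n$ has the gcd-property if $f_r=f_{\gcd(r,n)}$ for all $r\in\{1,\dots,n\}$. For $f$ with minimal period $N$ and constituents $f_j$ (indices mod $N$) and $m\in\mathbb{Z}$, $f^{\sigma^m}(t):=f_{j-m}(t)$ for $t\equiv j\bmod N$, and $\tilde f^{k}(t):=\frac1N\sum_{i=0}^{N-1}f^{\sigma^{ik}}(t)$; for $d\mid n$, $\tilde f^{d}$ has period $d$. $\operatorname{rad}(n)=\prod_{p\text{ prime},p\mid n}p$. -}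

module Defs where

open import Level using (Level; _⊔_)
open import Data.Nat as ℕ using (ℕ; zero; suc; NonZero; _<_)
open import Data.Nat.GCD using (gcd)
open import Data.Empty.Polymorphic using () renaming (⊥ to Lift⊥)
open import Data.Nat.Divisibility using (_∣_; _∣?_)
open import Data.Nat.Primality using (Prime; prime?)
open import Data.Integer as ℤ using (ℤ; +_; -[1+_])
open import Data.Integer.DivMod using (_%ℕ_)
open import Data.List using (List; []; _∷_; filter; upTo)
open import Data.Nat.ListAction using (product)
open import Data.Product using (Σ; _×_; _,_)
open import Data.Sum using (_⊎_)
open import Relation.Nullary using (¬_)
open import Relation.Nullary.Decidable using (_×-dec_)
open import Algebra.Bundles using (CommutativeRing)

rad : ℕ → ℕ
rad n = product (filter (λ p → prime? p ×-dec (p ∣? n)) (upTo (suc n)))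

-- Quasi-polynomials with values in a commutative ring R (the paper: R = ℂ).
module QP {c ℓ : Level} (R : CommutativeRing c ℓ) where
  open CommutativeRing R

  natR : ℕ → Carrier
  natR zero    = 0#
  natR (suc n) = 1# + natR n

  intR : ℤ → Carrier
  intR (+ n)      = natR n
  intR -[1+ n ]   = - natR (suc n)

  evalPoly : List Carrier → Carrier → Carrier
  evalPoly []       x = 0#
  evalPoly (a ∷ as) x = a + x * evalPoly as x

  IsPolyFn : (ℤ → Carrier) → Set (c ⊔ ℓ)
  IsPolyFn g = Σ (List Carrier) λ cs → ∀ t → g t ≈ evalPoly cs (intR t)

  -- f is a quasi-polynomial of period N with constituents g
  -- (constituent of residue r ∈ {0,…,N-1}; residue 0 is the paper's index N)
  IsQPWith : (ℤ → Carrier) → (N : ℕ) → .{{NonZero N}} → (ℕ → ℤ → Carrier) → Set (c ⊔ ℓ)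
  IsQPWith f N g = (∀ r → r < N → IsPolyFn (g r)) × (∀ t → f t ≈ g (t %ℕ N) t)

  IsPeriod : (ℤ → Carrier) → ℕ → Set (c ⊔ ℓ)
  IsPeriod f zero        = Lift⊥
  IsPeriod f N@(suc _)   = Σ (ℕ → ℤ → Carrier) λ g → IsQPWith f N g

  IsMinimalPeriod : (ℤ → Carrier) → ℕ → Set (c ⊔ ℓ)
  IsMinimalPeriod f N = IsPeriod f N × (∀ M → 0 < M → M < N → ¬ IsPeriod f M)

  GcdProperty : (n : ℕ) → .{{NonZero n}} → (ℕ → ℤ → Carrier) → Set ℓ
  GcdProperty n cst = ∀ r → 1 ℕ.≤ r → r ℕ.≤ n → ∀ t →
    cst (+ r %ℕ n) t ≈ cst (+ (gcd r n) %ℕ n) t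

  sumTo : ℕ → (ℕ → Carrier) → Carrier
  sumTo zero    a = 0#
  sumTo (suc N) a = sumTo N a + a N

  -- Constituent for t ≡ j (mod d) of  f̃^d = (1/N) Σ_{i<N} f^{σ^{i d}},
  -- where N is the minimal period of f, g its constituents for period N,
  -- and invN an inverse of N in R.  (f^{σ^m} has constituent g_{j-m} at j.)
  tildeConst : (N : ℕ) → .{{NonZero N}} → (ℕ → ℤ → Carrier) → Carrier →
               (d : ℕ) → (j : ℤ) → ℤ → Carrier
  tildeConst N g invN d j t =
    invN * sumTo N (λ i → g ((j ℤ.- (+ i) ℤ.* (+ d)) %ℕ N) t)

  IsChar0Domain : Set (c ⊔ ℓ)
  IsChar0Domain = (∀ m → ¬ (natR (suc m) ≈ 0#))
                × (∀ x y → x * y ≈ 0# → (x ≈ 0#) ⊎ (y ≈ 0#))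

module Submission where

-- The constituents of f for the periods N and n are polynomials agreeing on a residue class mod nN,
-- hence equal, so n · Σ_{i<N} g_{j−id}(t) = N · S(d) with S(d) = Σ_{i<n} c_{j−id}(t); cancelling n
-- (characteristic zero) reduces the claim to S(d₁) = S(d₂) for d₁ = gcd(k,n) = w·d₂, d₂ = gcd(k,rad n).
-- By the gcd-property c_x depends only on gcd(x,n), so it is unchanged when x is multiplied by a unit
-- mod n. Interleaving gives w · S(d₂) = Σ_{b<w} Σ_{i<n} c_{(j−bd₂)−id₁}(t). Each j − bd₂ is a unit mod d₂,
-- hence mod d₁ (which has the same prime factors), so it is u·j mod d₁ for some unit u mod n, and
-- multiplying by u and reindexing i ↦ ui − q turns each inner sum into S(d₁). Cancelling w gives the claim.

open import Defs
open import Level using (Level)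
open import Data.Nat using (ℕ; NonZero; _<_)
open import Data.Nat.GCD using (gcd)
open import Data.Integer using (ℤ; ∣_∣)
open import Relation.Binary.PropositionalEquality using (_≡_)
open import Relation.Nullary using (¬_)
open import Algebra.Bundles using (CommutativeRing)
open import Data.Nat.Coprimality using (gcd≡1⇒coprime)

module Arithmetic where
  open import Data.Nat.Base
  open import Data.Nat.Properties
  open import Data.Nat.Divisibility
  open import Data.Nat.Coprimality as Coprimality using (Coprime; coprime-divisor; gcd≡1⇒coprime)
  open import Data.Nat.GCD
  open import Data.Nat.Primality
  open import Data.Nat.Primality.Factorisation using (factorise; factorisationHasAllPrimeFactors)
  open import Data.Nat.Induction using (<-wellFounded)
  open import Data.Nat.ListAction using (product)
  open import Data.Nat.ListAction.Properties using (∈⇒∣product)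
  open import Data.List.Base using ([]; _∷_; filter; upTo)
  open import Data.List.Relation.Unary.All as All using (All; []; _∷_)
  open import Data.List.Relation.Unary.All.Properties using (All¬⇒¬Any)
  open import Data.List.Relation.Unary.AllPairs using ([]; _∷_)
  open import Data.List.Relation.Unary.Unique.Propositional using (Unique)
  open import Data.List.Relation.Unary.Unique.Propositional.Properties using (upTo⁺; filter⁺)
  open import Data.List.Membership.Propositional.Properties using (∈-filter⁺; ∈-filter⁻; ∈-upTo⁺)
  open import Data.Product.Base using (∃-syntax; _×_; _,_; proj₁; proj₂)
  open import Data.Sum.Base using (inj₁; inj₂)
  open import Induction.WellFounded using (Acc; acc)
  open import Relation.Binary.PropositionalEquality
  open import Relation.Nullary.Decidable using (_×-dec_)
  open import Relation.Nullary.Negation using (contradiction)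

  coprime-∣ˡ : ∀ {a b c} → c ∣ a → Coprime a b → Coprime c b
  coprime-∣ˡ c∣a a⊥b (d∣c , d∣b) = a⊥b (∣-trans d∣c c∣a , d∣b)

  coprime-∣ʳ : ∀ {a b c} → c ∣ b → Coprime a b → Coprime a c
  coprime-∣ʳ c∣b a⊥b (d∣a , d∣c) = a⊥b (d∣a , ∣-trans d∣c c∣b)

  coprime-*ʳ : ∀ {a x y} → Coprime a x → Coprime a y → Coprime a (x * y)
  coprime-*ʳ a⊥x a⊥y (d∣a , d∣xy) = a⊥y (d∣a , coprime-divisor (coprime-∣ˡ d∣a a⊥x) d∣xy)

  coprime-^ʳ : ∀ {a x} k → Coprime a x → Coprime a (x ^ k)
  coprime-^ʳ zero    _   (_ , d∣1) = ∣1⇒≡1 d∣1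
  coprime-^ʳ (suc k) a⊥x = coprime-*ʳ a⊥x (coprime-^ʳ k a⊥x)

  coprime-∣⇒*∣ : ∀ {a b n} → Coprime a b → a ∣ n → b ∣ n → a * b ∣ n
  coprime-∣⇒*∣ {a} {b} a⊥b a∣n (divides q refl) with coprime-divisor a⊥b (subst (a ∣_) (*-comm q b) a∣n)
  ... | divides r refl = divides r (*-assoc r a b)

  prime∤⇒coprime : ∀ {p m} → Prime p → ¬ p ∣ m → Coprime p m
  prime∤⇒coprime pp p∤m (d∣p , d∣m) with prime⇒irreducible pp d∣p
  ... | inj₁ d≡1 = d≡1
  ... | inj₂ refl = contradiction d∣m p∤m

  prime-factor : ∀ c → .{{NonTrivial c}} → ∃[ p ] Prime p × p ∣ c
  prime-factor c@(2+ _) with factorise c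
  ... | record { factors = [] ; isFactorisation = () }
  ... | record { factors = p ∷ ps ; isFactorisation = c≡Π ; factorsPrime = pp ∷ _ } =
    p , pp , subst (p ∣_) (sym c≡Π) (m∣m*n (product ps))

  coprime-by-prime-factors : ∀ {x d e} → .{{NonZero d}} →
    (∀ {p} → Prime p → p ∣ d → p ∣ e) → Coprime x e → Coprime x d
  coprime-by-prime-factors {d = d} _ _ {0} (_ , 0∣d) = contradiction (0∣⇒≡0 0∣d) (≢-nonZero⁻¹ d)
  coprime-by-prime-factors _ _ {1} _ = refl
  coprime-by-prime-factors primes⊆ x⊥e {c@(2+ _)} (c∣x , c∣d) with prime-factor c
  ... | p , pp , p∣c = contradiction (x⊥e (∣-trans p∣c c∣x , primes⊆ pp (∣-trans p∣c c∣d)))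
                                     (nonTrivial⇒≢1 {{prime⇒nonTrivial pp}})

  product-primes-∣ : ∀ {ps n} → Unique ps → All Prime ps → All (_∣ n) ps → product ps ∣ n
  product-primes-∣ {n = n} [] [] [] = 1∣ n
  product-primes-∣ (p∉ps ∷ distinct) (pp ∷ primes) (p∣n ∷ ps∣n) =
    coprime-∣⇒*∣ (prime∤⇒coprime pp p∤Πps) p∣n (product-primes-∣ distinct primes ps∣n)
    where
    p∤Πps = λ p∣Πps → All¬⇒¬Any p∉ps (factorisationHasAllPrimeFactors pp p∣Πps primes)

  module _ (n : ℕ) where
    private
      primeDivisor? = λ q → prime? q ×-dec (q ∣? n)

    rad∣n : rad n ∣ n
    rad∣n = product-primes-∣ (filter⁺ primeDivisor? (upTo⁺ (suc n)))
      (All.tabulate (λ q∈ → proj₁ (proj₂ (∈-filter⁻ primeDivisor? {xs = upTo (suc n)} q∈))))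
      (All.tabulate (λ q∈ → proj₂ (proj₂ (∈-filter⁻ primeDivisor? {xs = upTo (suc n)} q∈))))

    prime∣n⇒∣rad : .{{NonZero n}} → ∀ {p} → Prime p → p ∣ n → p ∣ rad n
    prime∣n⇒∣rad pp p∣n = ∈⇒∣product (∈-filter⁺ primeDivisor? (∈-upTo⁺ (s≤s (∣⇒≤ p∣n))) (pp , p∣n))

  gcd-rad∣gcd : ∀ k n → gcd k (rad n) ∣ gcd k n
  gcd-rad∣gcd k n = gcd-greatest (gcd[m,n]∣m k (rad n)) (∣-trans (gcd[m,n]∣n k (rad n)) (rad∣n n))

  prime∣gcd⇒∣gcd-rad : ∀ k n → .{{NonZero n}} → ∀ {p} → Prime p → p ∣ gcd k n → p ∣ gcd k (rad n)
  prime∣gcd⇒∣gcd-rad k n pp p∣gcd =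
    gcd-greatest (∣-trans p∣gcd (gcd[m,n]∣m k n)) (prime∣n⇒∣rad n pp (∣-trans p∣gcd (gcd[m,n]∣n k n)))

  gcd-by-common-divisors : ∀ {a b n} → (∀ {c} → c ∣ n → c ∣ a → c ∣ b) → (∀ {c} → c ∣ n → c ∣ b → c ∣ a) →
    gcd a n ≡ gcd b n
  gcd-by-common-divisors {a} {b} {n} a⇒b b⇒a = ∣-antisym
    (gcd-greatest (a⇒b (gcd[m,n]∣n a n) (gcd[m,n]∣m a n)) (gcd[m,n]∣n a n))
    (gcd-greatest (b⇒a (gcd[m,n]∣n b n) (gcd[m,n]∣m b n)) (gcd[m,n]∣n b n))

  gcd-*-coprime : ∀ {u n} m → Coprime u n → gcd (u * m) n ≡ gcd m n
  gcd-*-coprime {u} m u⊥n = gcd-by-common-divisors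
    (λ c∣n c∣um → coprime-divisor (coprime-∣ˡ c∣n (Coprimality.sym u⊥n)) c∣um)
    (λ _ c∣m → ∣n⇒∣m*n u c∣m)

  -- t is the largest divisor of m coprime to u, reached by repeatedly dividing m by gcd(m, u).
  coprime-part : ∀ u m → .{{NonZero m}} → ∃[ t ] ∃[ k ] Coprime t u × m ∣ t * u ^ k
  coprime-part u m = go m (<-wellFounded m)
    where
    go : ∀ m → .{{NonZero m}} → Acc _<_ m → ∃[ t ] ∃[ k ] Coprime t u × m ∣ t * u ^ k
    go m (acc rec) with gcd m u in g≡
    ... | 0 = contradiction (gcd[m,n]≡0⇒m≡0 g≡) (≢-nonZero⁻¹ m)
    ... | 1 = m , 0 , gcd≡1⇒coprime g≡ , m∣m*n 1
    ... | g@(2+ _) =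
      let t , k , t⊥u , m/g∣tuᵏ = go (quotient g∣m) {{quotient≢0 g∣m}} (rec (quotient-< g∣m))
      in t , suc k , t⊥u , subst₂ _∣_ (sym (_∣_.equality g∣m))
           (trans (*-assoc t (u ^ k) u) (cong (t *_) (*-comm (u ^ k) u)))
           (*-pres-∣ m/g∣tuᵏ (subst (_∣ u) g≡ (gcd[m,n]∣n m u)))
      where g∣m = subst (_∣ m) g≡ (gcd[m,n]∣m m u)

  -- u + d t is coprime to t (as u is) and to u (as d and t are), hence to n ∣ t uᵏ.
  unit-lift : ∀ {d n u} → .{{NonZero n}} → d ∣ n → Coprime u d → ∃[ t ] Coprime (u + d * t) n
  unit-lift {d} {n} {u} d∣n u⊥d = t , coprime-∣ʳ n∣tuᵏ (coprime-*ʳ w⊥t (coprime-^ʳ k w⊥u))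
    where
    part = coprime-part u n
    t = proj₁ part
    k = proj₁ (proj₂ part)
    t⊥u = proj₁ (proj₂ (proj₂ part))
    n∣tuᵏ = proj₂ (proj₂ (proj₂ part))
    w⊥t : Coprime (u + d * t) t
    w⊥t {c} (c∣w , c∣t) = t⊥u (c∣t , ∣m+n∣m⇒∣n (subst (c ∣_) (+-comm u (d * t)) c∣w) (∣n⇒∣m*n d c∣t))
    w⊥u : Coprime (u + d * t) u
    w⊥u (c∣w , c∣u) = coprime-*ʳ u⊥d (Coprimality.sym t⊥u) (c∣u , ∣m+n∣m⇒∣n c∣w c∣u)

module Congruence where
  open Arithmetic using (coprime-*ʳ; unit-lift; gcd-by-common-divisors)
  open import Data.Nat.Base as ℕ using (suc; _+_; _*_)
  import Data.Nat.Properties as ℕ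
  open import Data.Nat.Divisibility as ℕ using (_∣_)
  open import Data.Nat.DivMod using (m<n⇒m%n≡m)
  open import Data.Nat.Coprimality as Coprimality using (Coprime; coprime-Bézout; coprime⇒gcd≡1; gcd≡1⇒coprime)
  open import Data.Nat.GCD using (module Bézout)
  open import Data.Integer.Base as ℤ using (+_; -[1+_]; _%ℕ_; _/ℕ_; 0ℤ; 1ℤ)
  open import Data.Integer.Properties
  open import Data.Integer.DivMod using (a≡a%ℕn+[a/ℕn]*n; n%ℕd<d)
  open import Data.Integer.Divisibility.Signed as Signed
    using (divides; ∣ᵤ⇒∣; ∣⇒∣ᵤ; ∣m∣n⇒∣m+n; ∣m⇒∣-m; ∣n⇒∣m*n; ∣m+n∣m⇒∣n)
  open import Data.Integer.Tactic.RingSolver using (solve-∀)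
  open import Data.Product.Base using (∃-syntax; _×_; _,_; proj₁; proj₂)
  open import Relation.Binary.Bundles using (Setoid)
  open import Relation.Binary.Definitions using (tri<; tri≈; tri>)
  open import Relation.Binary.PropositionalEquality
  open import Relation.Nullary.Negation using (contradiction)

  infix 4 _≡_[mod_]

  record _≡_[mod_] (x y : ℤ) (n : ℕ) : Set where
    constructor mod-∣
    field ∣-diff : + n Signed.∣ x ℤ.- y

  private
    [x+x']-[y+y'] : ∀ x y x' y' → (x ℤ.+ x') ℤ.- (y ℤ.+ y') ≡ (x ℤ.- y) ℤ.+ (x' ℤ.- y')
    [x+x']-[y+y'] = solve-∀
    -[x-y] : ∀ x y → ℤ.- (x ℤ.- y) ≡ y ℤ.- x
    -[x-y] = solve-∀
    c*[x-y] : ∀ c x y → c ℤ.* (x ℤ.- y) ≡ c ℤ.* x ℤ.- c ℤ.* y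
    c*[x-y] = solve-∀
    [y+k]-y : ∀ y k → (y ℤ.+ k) ℤ.- y ≡ k
    [y+k]-y = solve-∀

  ≡[mod]-intro : ∀ {n x y} k → x ≡ y ℤ.+ k ℤ.* + n → x ≡ y [mod n ]
  ≡[mod]-intro {y = y} k refl = mod-∣ (divides k ([y+k]-y y _))

  ≡[mod]-reflexive : ∀ {n x y} → x ≡ y → x ≡ y [mod n ]
  ≡[mod]-reflexive {y = y} refl = ≡[mod]-intro 0ℤ (sym (+-identityʳ y))

  ≡[mod]-sym : ∀ {n x y} → x ≡ y [mod n ] → y ≡ x [mod n ]
  ≡[mod]-sym {x = x} {y} (mod-∣ n∣x-y) = mod-∣ (subst (_ Signed.∣_) (-[x-y] x y) (∣m⇒∣-m n∣x-y))

  ≡[mod]-trans : ∀ {n x y z} → x ≡ y [mod n ] → y ≡ z [mod n ] → x ≡ z [mod n ]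
  ≡[mod]-trans {x = x} {y} {z} (mod-∣ n∣x-y) (mod-∣ n∣y-z) =
    mod-∣ (subst (_ Signed.∣_) (+-minus-telescope x y z) (∣m∣n⇒∣m+n n∣x-y n∣y-z))

  ≡[mod]-setoid : ℕ → Setoid _ _
  ≡[mod]-setoid n = record
    { Carrier = ℤ
    ; _≈_ = _≡_[mod n ]
    ; isEquivalence = record { refl = ≡[mod]-reflexive refl ; sym = ≡[mod]-sym ; trans = ≡[mod]-trans }
    }

  ≡[mod]-+ : ∀ {n x y x' y'} → x ≡ y [mod n ] → x' ≡ y' [mod n ] → x ℤ.+ x' ≡ y ℤ.+ y' [mod n ]
  ≡[mod]-+ {x = x} {y} {x'} {y'} (mod-∣ n∣x-y) (mod-∣ n∣x'-y') =
    mod-∣ (subst (_ Signed.∣_) (sym ([x+x']-[y+y'] x y x' y')) (∣m∣n⇒∣m+n n∣x-y n∣x'-y'))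

  ≡[mod]-+ˡ : ∀ {n x y} c → x ≡ y [mod n ] → c ℤ.+ x ≡ c ℤ.+ y [mod n ]
  ≡[mod]-+ˡ c = ≡[mod]-+ (≡[mod]-reflexive {x = c} refl)

  ≡[mod]-+ʳ : ∀ {n x y} c → x ≡ y [mod n ] → x ℤ.+ c ≡ y ℤ.+ c [mod n ]
  ≡[mod]-+ʳ c x≡y = ≡[mod]-+ x≡y (≡[mod]-reflexive {x = c} refl)

  ≡[mod]-neg : ∀ {n x y} → x ≡ y [mod n ] → ℤ.- x ≡ ℤ.- y [mod n ]
  ≡[mod]-neg {x = x} {y} (mod-∣ n∣x-y) = mod-∣ (subst (_ Signed.∣_) (neg-distrib-+ x (ℤ.- y)) (∣m⇒∣-m n∣x-y))

  ≡[mod]-*ˡ : ∀ {n x y} c → x ≡ y [mod n ] → c ℤ.* x ≡ c ℤ.* y [mod n ]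
  ≡[mod]-*ˡ {x = x} {y} c (mod-∣ n∣x-y) = mod-∣ (subst (_ Signed.∣_) (c*[x-y] c x y) (∣n⇒∣m*n c n∣x-y))

  ≡[mod]-*ʳ : ∀ {n x y} c → x ≡ y [mod n ] → x ℤ.* c ≡ y ℤ.* c [mod n ]
  ≡[mod]-*ʳ {x = x} {y} c x≡y = subst₂ _≡_[mod _ ] (*-comm c x) (*-comm c y) (≡[mod]-*ˡ c x≡y)

  ≡[mod]-∣ : ∀ {d n x y} → d ∣ n → x ≡ y [mod n ] → x ≡ y [mod d ]
  ≡[mod]-∣ d∣n (mod-∣ n∣x-y) = mod-∣ (Signed.∣-trans (∣ᵤ⇒∣ d∣n) n∣x-y)

  ≡[mod]-%ℕ : ∀ n .{{_ : NonZero n}} x → x ≡ + (x %ℕ n) [mod n ]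
  ≡[mod]-%ℕ n x = ≡[mod]-intro (x /ℕ n) (a≡a%ℕn+[a/ℕn]*n x n)

  ≡[mod]-sub-multiple : ∀ n a k → a ℤ.- k ℤ.* + n ≡ a [mod n ]
  ≡[mod]-sub-multiple n a k = ≡[mod]-sym (≡[mod]-intro k (a≡[a-kn]+kn a k (+ n)))
    where
    a≡[a-kn]+kn : ∀ a k n → a ≡ (a ℤ.- k ℤ.* n) ℤ.+ k ℤ.* n
    a≡[a-kn]+kn = solve-∀

  ≡[mod]-step : ∀ n a i d → a ℤ.- + (n + i) ℤ.* d ≡ a ℤ.- + i ℤ.* d [mod n ]
  ≡[mod]-step n a i d = ≡[mod]-intro (ℤ.- d) (trans (cong (λ m → a ℤ.- m ℤ.* d) (pos-+ n i)) (shift a (+ n) (+ i) d))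
    where
    shift : ∀ a n i d → a ℤ.- (n ℤ.+ i) ℤ.* d ≡ (a ℤ.- i ℤ.* d) ℤ.+ ℤ.- d ℤ.* n
    shift = solve-∀

  ≡[mod]-∣-abs : ∀ {n c x y} → x ≡ y [mod n ] → c ∣ n → c ∣ ∣ x ∣ → c ∣ ∣ y ∣
  ≡[mod]-∣-abs {c = c} {x} {y} (mod-∣ n∣x-y) c∣n c∣x = subst (c ∣_) (∣-i∣≡∣i∣ y)
    (∣⇒∣ᵤ (∣m+n∣m⇒∣n {+ c} {x} (Signed.∣-trans (∣ᵤ⇒∣ c∣n) n∣x-y) (∣ᵤ⇒∣ {+ c} {x} c∣x)))

  ≡[mod]-gcd : ∀ {n x y} → x ≡ y [mod n ] → gcd (∣ x ∣) n ≡ gcd (∣ y ∣) n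
  ≡[mod]-gcd x≡y = gcd-by-common-divisors (≡[mod]-∣-abs x≡y) (≡[mod]-∣-abs (≡[mod]-sym x≡y))

  ≡[mod]-coprime : ∀ {n x y} → x ≡ y [mod n ] → Coprime ∣ x ∣ n → Coprime ∣ y ∣ n
  ≡[mod]-coprime x≡y x⊥n = gcd≡1⇒coprime (trans (sym (≡[mod]-gcd x≡y)) (coprime⇒gcd≡1 x⊥n))

  private
    ≢[mod]-< : ∀ {n a b} → a < b → b < n → ¬ (+ a ≡ + b [mod n ])
    ≢[mod]-< {n} {a} {b} a<b b<n (mod-∣ n∣a-b) = ℕ.<⇒≱ (ℕ.≤-<-trans (ℕ.m∸n≤m b a) b<n) (ℕ.∣⇒≤ n∣b∸a)
      where
      instance _ = ℕ.>-nonZero (ℕ.m<n⇒0<n∸m a<b)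
      n∣b∸a : n ∣ b ℕ.∸ a
      n∣b∸a = subst (n ∣_) (trans (cong ∣_∣ ([+m]-[+n]≡m⊖n a b)) (∣⊖∣-< a<b)) (∣⇒∣ᵤ n∣a-b)

  ≡[mod]⇒≡ : ∀ {n a b} → a < n → b < n → + a ≡ + b [mod n ] → a ≡ b
  ≡[mod]⇒≡ {a = a} {b} a<n b<n a≡b with ℕ.<-cmp a b
  ... | tri< a<b _ _ = contradiction a≡b (≢[mod]-< a<b b<n)
  ... | tri≈ _ a≡b _ = a≡b
  ... | tri> _ _ b<a = contradiction (≡[mod]-sym a≡b) (≢[mod]-< b<a a<n)

  ≡[mod]⇒%ℕ≡ : ∀ {n} .{{_ : NonZero n}} {x y} → x ≡ y [mod n ] → x %ℕ n ≡ y %ℕ n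
  ≡[mod]⇒%ℕ≡ {n} {x = x} {y} x≡y = ≡[mod]⇒≡ (n%ℕd<d x n) (n%ℕd<d y n)
    (≡[mod]-trans (≡[mod]-sym (≡[mod]-%ℕ n x)) (≡[mod]-trans x≡y (≡[mod]-%ℕ n y)))

  ≡[mod]⇒%ℕ≡-< : ∀ {n} .{{_ : NonZero n}} {x i} → i < n → x ≡ + i [mod n ] → x %ℕ n ≡ i
  ≡[mod]⇒%ℕ≡-< i<n x≡i = trans (≡[mod]⇒%ℕ≡ x≡i) (m<n⇒m%n≡m i<n)

  private
    pos-1+* : ∀ a b → + (1 + a * b) ≡ 1ℤ ℤ.+ + a ℤ.* + b
    pos-1+* a b = trans (pos-+ 1 (a * b)) (cong (λ z → 1ℤ ℤ.+ z) (pos-* a b))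
    m*-x≡1-[1+xm] : ∀ m x → m ℤ.* ℤ.- x ≡ 1ℤ ℤ.+ ℤ.- (1ℤ ℤ.+ x ℤ.* m)
    m*-x≡1-[1+xm] = solve-∀
    -x*-y≡x*y : ∀ x y → ℤ.- x ℤ.* ℤ.- y ≡ x ℤ.* y
    -x*-y≡x*y = solve-∀

  inverse-mod-ℕ : ∀ {m n} → Coprime m n → ∃[ b ] + m ℤ.* b ≡ 1ℤ [mod n ]
  inverse-mod-ℕ {m} {n} m⊥n with coprime-Bézout m⊥n
  ... | Bézout.+- x y eq = + x , ≡[mod]-intro (+ y) (begin
    + m ℤ.* + x            ≡⟨ sym (pos-* m x) ⟩
    + (m * x)              ≡⟨ cong +_ (trans (ℕ.*-comm m x) (sym eq)) ⟩
    + (1 + y * n)          ≡⟨ pos-1+* y n ⟩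
    1ℤ ℤ.+ + y ℤ.* + n     ∎)
    where open ≡-Reasoning
  ... | Bézout.-+ x y eq = ℤ.- + x , ≡[mod]-intro (ℤ.- + y) (begin
    + m ℤ.* ℤ.- + x                  ≡⟨ m*-x≡1-[1+xm] (+ m) (+ x) ⟩
    1ℤ ℤ.+ ℤ.- (1ℤ ℤ.+ + x ℤ.* + m)  ≡⟨ cong (λ z → 1ℤ ℤ.+ ℤ.- z) (trans (sym (pos-1+* x m)) (cong +_ eq)) ⟩
    1ℤ ℤ.+ ℤ.- + (y * n)             ≡⟨ cong (λ z → 1ℤ ℤ.+ ℤ.- z) (pos-* y n) ⟩
    1ℤ ℤ.+ ℤ.- (+ y ℤ.* + n)         ≡⟨ cong (λ z → 1ℤ ℤ.+ z) (neg-distribˡ-* (+ y) (+ n)) ⟩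
    1ℤ ℤ.+ ℤ.- + y ℤ.* + n           ∎)
    where open ≡-Reasoning

  inverse-mod : ∀ {n} a → Coprime ∣ a ∣ n → ∃[ b ] a ℤ.* b ≡ 1ℤ [mod n ]
  inverse-mod (+ m)    m⊥n = inverse-mod-ℕ m⊥n
  inverse-mod -[1+ m ] m⊥n with inverse-mod-ℕ m⊥n
  ... | b , mb≡1 = ℤ.- b , ≡[mod]-trans (≡[mod]-reflexive (-x*-y≡x*y (+ suc m) b)) mb≡1

  inverse⇒coprime : ∀ {n a b} → a ℤ.* b ≡ 1ℤ [mod n ] → Coprime ∣ b ∣ n
  inverse⇒coprime {a = a} {b} ab≡1 {c} (c∣b , c∣n) =
    ℕ.∣1⇒≡1 (≡[mod]-∣-abs ab≡1 c∣n (subst (c ∣_) (sym (abs-* a b)) (ℕ.∣n⇒∣m*n ∣ a ∣ c∣b)))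

  unit-multiplier : ∀ {d n} a a' → .{{NonZero n}} → .{{NonZero d}} → d ∣ n →
    Coprime ∣ a ∣ n → Coprime ∣ a' ∣ d → ∃[ u ] Coprime u n × + u ℤ.* a ≡ a' [mod d ]
  unit-multiplier {d} {n} a a' d∣n a⊥n a'⊥d = u₀ + d * t , u⊥n , ua≡a'
    where
    b = proj₁ (inverse-mod a a⊥n)
    ab≡1 : a ℤ.* b ≡ 1ℤ [mod d ]
    ab≡1 = ≡[mod]-∣ d∣n (proj₂ (inverse-mod a a⊥n))
    a'b⊥d : Coprime ∣ a' ℤ.* b ∣ d
    a'b⊥d = subst (λ m → Coprime m d) (sym (abs-* a' b))
      (Coprimality.sym (coprime-*ʳ (Coprimality.sym a'⊥d) (Coprimality.sym (inverse⇒coprime {a = a} ab≡1))))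
    u₀ = (a' ℤ.* b) %ℕ d
    lifted = unit-lift d∣n (≡[mod]-coprime (≡[mod]-%ℕ d (a' ℤ.* b)) a'b⊥d)
    t = proj₁ lifted
    u⊥n = proj₂ lifted
    cast : + (u₀ + d * t) ≡ + u₀ ℤ.+ + t ℤ.* + d
    cast = trans (pos-+ u₀ (d * t)) (cong (λ z → + u₀ ℤ.+ z) (trans (cong +_ (ℕ.*-comm d t)) (pos-* t d)))
    reassociate : ∀ x y z → x ℤ.* y ℤ.* z ≡ x ℤ.* (z ℤ.* y)
    reassociate = solve-∀
    open import Relation.Binary.Reasoning.Setoid (≡[mod]-setoid d)
    ua≡a' : + (u₀ + d * t) ℤ.* a ≡ a' [mod d ]
    ua≡a' = begin
      + (u₀ + d * t) ℤ.* a   ≈⟨ ≡[mod]-*ʳ a (≡[mod]-intro {y = + u₀} (+ t) cast) ⟩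
      + u₀ ℤ.* a             ≈⟨ ≡[mod]-*ʳ a (≡[mod]-%ℕ d (a' ℤ.* b)) ⟨
      a' ℤ.* b ℤ.* a         ≡⟨ reassociate a' b a ⟩
      a' ℤ.* (a ℤ.* b)       ≈⟨ ≡[mod]-*ˡ a' ab≡1 ⟩
      a' ℤ.* 1ℤ              ≡⟨ *-identityʳ a' ⟩
      a'                     ∎

  affine-coset : ∀ {u a a' q d} → u ℤ.* a ℤ.- a' ≡ q ℤ.* d → ∀ i →
    u ℤ.* (a ℤ.- i ℤ.* d) ≡ a' ℤ.- (u ℤ.* i ℤ.+ ℤ.- q) ℤ.* d
  affine-coset {u} {a} {a'} {q} {d} ua-a'≡qd i = begin
    u ℤ.* (a ℤ.- i ℤ.* d)                                ≡⟨ expand u a a' i q d ⟩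
    e ℤ.+ ((u ℤ.* a ℤ.- a') ℤ.- q ℤ.* d)                 ≡⟨ cong (λ z → e ℤ.+ (z ℤ.- q ℤ.* d)) ua-a'≡qd ⟩
    e ℤ.+ (q ℤ.* d ℤ.- q ℤ.* d)                          ≡⟨ cong (λ z → e ℤ.+ z) (+-inverseʳ (q ℤ.* d)) ⟩
    e ℤ.+ 0ℤ                                             ≡⟨ +-identityʳ e ⟩
    e                                                    ∎
    where
    open ≡-Reasoning
    e = a' ℤ.- (u ℤ.* i ℤ.+ ℤ.- q) ℤ.* d
    expand : ∀ u a a' i q d → u ℤ.* (a ℤ.- i ℤ.* d) ≡
      a' ℤ.- (u ℤ.* i ℤ.+ ℤ.- q) ℤ.* d ℤ.+ ((u ℤ.* a ℤ.- a') ℤ.- q ℤ.* d)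
    expand = solve-∀

  module Affine (n : ℕ) .{{_ : NonZero n}} {u v : ℤ} (uv≡1 : u ℤ.* v ≡ 1ℤ [mod n ]) (c : ℤ) where
    open import Relation.Binary.Reasoning.Setoid (≡[mod]-setoid n)

    affine : ℕ → ℕ
    affine i = (u ℤ.* + i ℤ.+ c) %ℕ n

    affine⁻¹ : ℕ → ℕ
    affine⁻¹ i = (v ℤ.* (+ i ℤ.- c)) %ℕ n

    affine<n : ∀ i → affine i < n
    affine<n i = n%ℕd<d (u ℤ.* + i ℤ.+ c) n

    affine⁻¹<n : ∀ i → affine⁻¹ i < n
    affine⁻¹<n i = n%ℕd<d (v ℤ.* (+ i ℤ.- c)) n

    private
      u*[v*[x-c]]+c : ∀ u v x c → u ℤ.* (v ℤ.* (x ℤ.- c)) ℤ.+ c ≡ (u ℤ.* v) ℤ.* (x ℤ.- c) ℤ.+ c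
      u*[v*[x-c]]+c = solve-∀
      1*[x-c]+c : ∀ x c → 1ℤ ℤ.* (x ℤ.- c) ℤ.+ c ≡ x
      1*[x-c]+c = solve-∀
      v*[[u*x+c]-c] : ∀ u v x c → v ℤ.* ((u ℤ.* x ℤ.+ c) ℤ.- c) ≡ (u ℤ.* v) ℤ.* x
      v*[[u*x+c]-c] = solve-∀

    affine-inverseˡ : ∀ i → i < n → affine (affine⁻¹ i) ≡ i
    affine-inverseˡ i i<n = ≡[mod]⇒%ℕ≡-< i<n (begin
      u ℤ.* + affine⁻¹ i ℤ.+ c              ≈⟨ ≡[mod]-+ʳ c (≡[mod]-*ˡ u (≡[mod]-%ℕ n (v ℤ.* (+ i ℤ.- c)))) ⟨
      u ℤ.* (v ℤ.* (+ i ℤ.- c)) ℤ.+ c       ≡⟨ u*[v*[x-c]]+c u v (+ i) c ⟩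
      (u ℤ.* v) ℤ.* (+ i ℤ.- c) ℤ.+ c       ≈⟨ ≡[mod]-+ʳ c (≡[mod]-*ʳ (+ i ℤ.- c) uv≡1) ⟩
      1ℤ ℤ.* (+ i ℤ.- c) ℤ.+ c              ≡⟨ 1*[x-c]+c (+ i) c ⟩
      + i                                   ∎)

    affine-inverseʳ : ∀ i → i < n → affine⁻¹ (affine i) ≡ i
    affine-inverseʳ i i<n = ≡[mod]⇒%ℕ≡-< i<n (begin
      v ℤ.* (+ affine i ℤ.- c)              ≈⟨ ≡[mod]-*ˡ v (≡[mod]-+ʳ (ℤ.- c) (≡[mod]-%ℕ n (u ℤ.* + i ℤ.+ c))) ⟨
      v ℤ.* ((u ℤ.* + i ℤ.+ c) ℤ.- c)       ≡⟨ v*[[u*x+c]-c] u v (+ i) c ⟩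
      (u ℤ.* v) ℤ.* + i                     ≈⟨ ≡[mod]-*ʳ (+ i) uv≡1 ⟩
      1ℤ ℤ.* + i                            ≡⟨ *-identityˡ (+ i) ⟩
      + i                                   ∎)

module Summation {c ℓ : Level} (R : CommutativeRing c ℓ) where
  open CommutativeRing R
  open QP R
  open Congruence
  open import Data.Nat.Base as ℕ using (zero; suc)
  import Data.Nat.Properties as ℕ
  open import Data.Nat.Coprimality using (Coprime)
  open import Data.Integer.Base as ℤ using (+_; _%ℕ_)
  open import Data.Fin.Base using (Fin; toℕ; fromℕ<; inject₁; fromℕ)
  import Data.Fin.Properties as Fin
  open import Data.Fin.Permutation using (permutation)
  open import Data.Product.Base using (proj₂)
  open import Function.Base using (_∘_)
  import Relation.Binary.PropositionalEquality as ≡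
  open import Algebra.Properties.CommutativeMonoid.Sum +-commutativeMonoid using (sum; sum-init-last; sum-permute; sum-cong-≗)
  open import Algebra.Properties.CommutativeSemigroup +-commutativeSemigroup using (interchange)
  open import Relation.Binary.Reasoning.Setoid setoid

  sumTo-cong : ∀ N {a b : ℕ → Carrier} → (∀ i → a i ≈ b i) → sumTo N a ≈ sumTo N b
  sumTo-cong zero    a≈b = refl
  sumTo-cong (suc N) a≈b = +-cong (sumTo-cong N a≈b) (a≈b N)

  sumTo-+ : ∀ k m F → sumTo (k ℕ.+ m) F ≈ sumTo m F + sumTo k (λ i → F (m ℕ.+ i))
  sumTo-+ zero    m F = sym (+-identityʳ _)
  sumTo-+ (suc k) m F = begin
    sumTo (k ℕ.+ m) F + F (k ℕ.+ m)                            ≈⟨ +-cong (sumTo-+ k m F) (reflexive (≡.cong F (ℕ.+-comm k m))) ⟩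
    (sumTo m F + sumTo k (λ i → F (m ℕ.+ i))) + F (m ℕ.+ k)  ≈⟨ +-assoc _ _ _ ⟩
    sumTo m F + (sumTo k (λ i → F (m ℕ.+ i)) + F (m ℕ.+ k))  ∎

  sumTo-distrib-+ : ∀ N (a b : ℕ → Carrier) → sumTo N (λ i → a i + b i) ≈ sumTo N a + sumTo N b
  sumTo-distrib-+ zero    a b = sym (+-identityʳ 0#)
  sumTo-distrib-+ (suc N) a b = begin
    sumTo N (λ i → a i + b i) + (a N + b N)  ≈⟨ +-congʳ (sumTo-distrib-+ N a b) ⟩
    (sumTo N a + sumTo N b) + (a N + b N)    ≈⟨ interchange _ _ _ _ ⟩
    (sumTo N a + a N) + (sumTo N b + b N)    ∎

  sumTo-const : ∀ q x → sumTo q (λ _ → x) ≈ natR q * x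
  sumTo-const zero    x = sym (zeroˡ x)
  sumTo-const (suc q) x = begin
    sumTo q (λ _ → x) + x   ≈⟨ +-cong (sumTo-const q x) (sym (*-identityˡ x)) ⟩
    natR q * x + 1# * x     ≈⟨ +-comm _ _ ⟩
    1# * x + natR q * x     ≈⟨ distribʳ x 1# (natR q) ⟨
    (1# + natR q) * x       ∎

  sumTo-swap : ∀ p q (F : ℕ → ℕ → Carrier) →
    sumTo p (λ i → sumTo q (F i)) ≈ sumTo q (λ b → sumTo p (λ i → F i b))
  sumTo-swap zero    q F = sym (trans (sumTo-const q 0#) (zeroʳ _))
  sumTo-swap (suc p) q F = begin
    sumTo p (λ i → sumTo q (F i)) + sumTo q (F p)          ≈⟨ +-congʳ (sumTo-swap p q F) ⟩
    sumTo q (λ b → sumTo p (λ i → F i b)) + sumTo q (F p)  ≈⟨ sumTo-distrib-+ q _ _ ⟨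
    sumTo q (λ b → sumTo p (λ i → F i b) + F p b)          ∎

  sumTo-blocks : ∀ q p F → sumTo (q ℕ.* p) F ≈ sumTo q (λ i → sumTo p (λ b → F (i ℕ.* p ℕ.+ b)))
  sumTo-blocks zero    p F = refl
  sumTo-blocks (suc q) p F = trans (sumTo-+ p (q ℕ.* p) F) (+-congʳ (sumTo-blocks q p F))

  sumTo-periodic : ∀ q p F → (∀ i → F (p ℕ.+ i) ≈ F i) → sumTo (q ℕ.* p) F ≈ natR q * sumTo p F
  sumTo-periodic q p F F-periodic = begin
    sumTo (q ℕ.* p) F                                   ≈⟨ sumTo-blocks q p F ⟩
    sumTo q (λ i → sumTo p (λ b → F (i ℕ.* p ℕ.+ b)))   ≈⟨ sumTo-cong q (λ i → sumTo-cong p (shift i)) ⟩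
    sumTo q (λ _ → sumTo p F)                           ≈⟨ sumTo-const q _ ⟩
    natR q * sumTo p F                                  ∎
    where
    shift : ∀ i b → F (i ℕ.* p ℕ.+ b) ≈ F b
    shift zero    b = refl
    shift (suc i) b = trans (reflexive (≡.cong F (ℕ.+-assoc p (i ℕ.* p) b))) (trans (F-periodic _) (shift i b))

  sumTo-interleave : ∀ w n F → (∀ i → F (n ℕ.+ i) ≈ F i) →
    natR w * sumTo n F ≈ sumTo w (λ b → sumTo n (λ i → F (i ℕ.* w ℕ.+ b)))
  sumTo-interleave w n F F-periodic = begin
    natR w * sumTo n F                                 ≈⟨ sumTo-periodic w n F F-periodic ⟨
    sumTo (w ℕ.* n) F                                  ≡⟨ ≡.cong (λ m → sumTo m F) (ℕ.*-comm w n) ⟩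
    sumTo (n ℕ.* w) F                                  ≈⟨ sumTo-blocks n w F ⟩
    sumTo n (λ i → sumTo w (λ b → F (i ℕ.* w ℕ.+ b)))  ≈⟨ sumTo-swap n w _ ⟩
    sumTo w (λ b → sumTo n (λ i → F (i ℕ.* w ℕ.+ b)))  ∎

  sumTo≈sum : ∀ N F → sumTo N F ≈ sum {N} (F ∘ toℕ)
  sumTo≈sum zero    F = refl
  sumTo≈sum (suc N) F = begin
    sumTo N F + F N                                   ≈⟨ +-congʳ (sumTo≈sum N F) ⟩
    sum {N} (F ∘ toℕ) + F N                           ≡⟨ ≡.cong₂ _+_ (sum-cong-≗ {N} (≡.cong F ∘ ≡.sym ∘ Fin.toℕ-inject₁))
                                                                      (≡.cong F (≡.sym (Fin.toℕ-fromℕ N))) ⟩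
    sum {N} (F ∘ toℕ ∘ inject₁) + F (toℕ (fromℕ N))   ≈⟨ sum-init-last (F ∘ toℕ) ⟨
    sum {suc N} (F ∘ toℕ)                             ∎

  sumTo-reindex : ∀ n (σ τ : ℕ → ℕ) → (∀ i → σ i < n) → (∀ i → τ i < n) →
    (∀ i → i < n → σ (τ i) ≡ i) → (∀ i → i < n → τ (σ i) ≡ i) →
    ∀ F → sumTo n F ≈ sumTo n (F ∘ σ)
  sumTo-reindex n σ τ σ<n τ<n στ≡id τσ≡id F = begin
    sumTo n F                ≈⟨ sumTo≈sum n F ⟩
    sum {n} (F ∘ toℕ)        ≈⟨ sum-permute (F ∘ toℕ) (permutation σ̂ τ̂ (inverse σ τ σ<n τ<n στ≡id) (inverse τ σ τ<n σ<n τσ≡id)) ⟩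
    sum {n} (F ∘ toℕ ∘ σ̂)   ≡⟨ sum-cong-≗ {n} (λ i → ≡.cong F (Fin.toℕ-fromℕ< (σ<n (toℕ i)))) ⟩
    sum {n} (F ∘ σ ∘ toℕ)    ≈⟨ sumTo≈sum n (F ∘ σ) ⟨
    sumTo n (F ∘ σ)          ∎
    where
    σ̂ τ̂ : Fin n → Fin n
    σ̂ i = fromℕ< (σ<n (toℕ i))
    τ̂ i = fromℕ< (τ<n (toℕ i))
    inverse : ∀ ρ ρ' (ρ<n : ∀ i → ρ i < n) (ρ'<n : ∀ i → ρ' i < n) → (∀ i → i < n → ρ (ρ' i) ≡ i) →
      ∀ i → fromℕ< (ρ<n (toℕ (fromℕ< (ρ'<n (toℕ i))))) ≡ i
    inverse ρ ρ' ρ<n ρ'<n ρρ'≡id i = Fin.toℕ-injective (≡.trans (Fin.toℕ-fromℕ< (ρ<n _))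
      (≡.trans (≡.cong ρ (Fin.toℕ-fromℕ< (ρ'<n (toℕ i)))) (ρρ'≡id (toℕ i) (Fin.toℕ<n i))))

  sumTo-affine : ∀ n .{{_ : NonZero n}} (F : ℤ → Carrier) → (∀ {x y} → x ≡ y [mod n ] → F x ≈ F y) →
    ∀ u → Coprime ∣ u ∣ n → ∀ c → sumTo n (λ i → F (+ i)) ≈ sumTo n (λ i → F (u ℤ.* + i ℤ.+ c))
  sumTo-affine n F F-resp u u⊥n c = begin
    sumTo n (F ∘ +_)                      ≈⟨ sumTo-reindex n affine affine⁻¹ affine<n affine⁻¹<n affine-inverseˡ affine-inverseʳ (F ∘ +_) ⟩
    sumTo n (F ∘ +_ ∘ affine)             ≈⟨ sumTo-cong n (λ i → F-resp (≡[mod]-%ℕ n (u ℤ.* + i ℤ.+ c))) ⟨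
    sumTo n (λ i → F (u ℤ.* + i ℤ.+ c))   ∎
    where open Affine n {u} (proj₂ (inverse-mod u u⊥n)) c

module Polynomial {c ℓ : Level} (R : CommutativeRing c ℓ) where
  open CommutativeRing R
  open QP R
  open import Data.Nat.Base as ℕ using (zero; suc; pred; _≤_)
  import Data.Nat.Properties as ℕ
  open import Data.Integer.Base using (+_)
  open import Data.List.Base using (List; []; _∷_; length)
  open import Data.Maybe.Base using (nothing)
  open import Data.Product.Base using (_,_)
  open import Data.Sum.Base using (inj₁; inj₂; _⊎_)
  open import Function.Base using (_∘_)
  open import Function.Definitions using (Injective)
  open import Relation.Nullary.Negation using (contradiction)
  import Relation.Binary.PropositionalEquality as ≡
  open import Algebra.Definitions _≈_ using (AlmostLeftCancellative)
  open import Algebra.Properties.Ring ring using (x[y-z]≈xy-xz)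
  open import Algebra.Properties.Group +-group using (x∙y⁻¹≈ε⇒x≈y; x≈y⇒x∙y⁻¹≈ε; ∙-cancelˡ; ∙-cancelʳ; //-rightDividesˡ)
  open import Tactic.RingSolver.Core.AlmostCommutativeRing using (fromCommutativeRing)
  open import Tactic.RingSolver.NonReflective (fromCommutativeRing R (λ _ → nothing))
    using (solve; _⊜_; _⊕_; _⊗_)
  open import Relation.Binary.Reasoning.Setoid setoid

  *-almostCancelˡ : (∀ x y → x * y ≈ 0# → x ≈ 0# ⊎ y ≈ 0#) → AlmostLeftCancellative 0# _*_
  *-almostCancelˡ noZeroDivisors x y z x≉0 xy≈xz with noZeroDivisors x (y - z) (trans (x[y-z]≈xy-xz x y z) (x≈y⇒x∙y⁻¹≈ε xy≈xz))
  ... | inj₁ x≈0   = contradiction x≈0 x≉0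
  ... | inj₂ y-z≈0 = x∙y⁻¹≈ε⇒x≈y y z y-z≈0

  natR-injective : (∀ m → ¬ (natR (suc m) ≈ 0#)) → ∀ m n → natR m ≈ natR n → m ≡ n
  natR-injective char zero    zero    _     = ≡.refl
  natR-injective char zero    (suc n) 0≈n+1 = contradiction (sym 0≈n+1) (char n)
  natR-injective char (suc m) zero    m+1≈0 = contradiction m+1≈0 (char m)
  natR-injective char (suc m) (suc n) m+1≈n+1 = ≡.cong suc (natR-injective char m n (∙-cancelˡ 1# _ _ m+1≈n+1))

  natR-cancelˡ : IsChar0Domain → ∀ m .{{_ : NonZero m}} → ∀ {x y} → natR m * x ≈ natR m * y → x ≈ y
  natR-cancelˡ (char , noZeroDivisors) (suc m) = *-almostCancelˡ noZeroDivisors (natR (suc m)) _ _ (char m)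

  -- Synthetic division by (X − z): the coefficients of the quotient are the values at z of the tails.
  deflate : Carrier → List Carrier → List Carrier
  deflate z []           = []
  deflate z (a ∷ [])     = []
  deflate z (a ∷ b ∷ bs) = evalPoly (b ∷ bs) z ∷ deflate z (b ∷ bs)

  length-deflate : ∀ z cs → length (deflate z cs) ≡ pred (length cs)
  length-deflate z []           = ≡.refl
  length-deflate z (a ∷ [])     = ≡.refl
  length-deflate z (a ∷ b ∷ bs) = ≡.cong suc (length-deflate z (b ∷ bs))

  evalPoly-deflate : ∀ z cs y → evalPoly cs y ≈ (y - z) * evalPoly (deflate z cs) y + evalPoly cs z
  evalPoly-deflate z []       y = sym (trans (+-identityʳ _) (zeroʳ _))
  evalPoly-deflate z (a ∷ []) y = begin
    a + y * 0#                   ≈⟨ +-congˡ (trans (zeroʳ y) (sym (zeroʳ z))) ⟩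
    a + z * 0#                   ≈⟨ +-identityˡ _ ⟨
    0# + (a + z * 0#)            ≈⟨ +-congʳ (zeroʳ (y - z)) ⟨
    (y - z) * 0# + (a + z * 0#)  ∎
  -- The solver has no zero test on coefficients, so it cannot cancel −z + z: y − z is kept as an
  -- atom w and y · B z is rewritten to w · B z + z · B z by hand.
  evalPoly-deflate z (a ∷ b ∷ bs) y = begin
    a + y * B y                              ≈⟨ +-congˡ (*-congˡ (evalPoly-deflate z (b ∷ bs) y)) ⟩
    a + y * (w * Q + B z)                    ≈⟨ solve 5 (λ a y w Q Bz → (a ⊕ y ⊗ (w ⊗ Q ⊕ Bz)) ⊜ ((a ⊕ y ⊗ (w ⊗ Q)) ⊕ y ⊗ Bz))
                                                  refl a y w Q (B z) ⟩
    (a + y * (w * Q)) + y * B z              ≈⟨ +-congˡ (trans (*-congʳ (sym (//-rightDividesˡ z y))) (distribʳ (B z) w z)) ⟩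
    (a + y * (w * Q)) + (w * B z + z * B z)  ≈⟨ solve 6 (λ a y w z Q Bz → ((a ⊕ y ⊗ (w ⊗ Q)) ⊕ (w ⊗ Bz ⊕ z ⊗ Bz))
                                                                         ⊜ (w ⊗ (Bz ⊕ y ⊗ Q) ⊕ (a ⊕ z ⊗ Bz)))
                                                  refl a y w z Q (B z) ⟩
    w * (B z + y * Q) + (a + z * B z)        ∎
    where
    B = evalPoly (b ∷ bs)
    Q = evalPoly (deflate z (b ∷ bs)) y
    w = y - z

  evalPoly-unique : IsChar0Domain → ∀ {L} cs ds → length cs ≤ L → length ds ≤ L →
    ∀ h → Injective _≡_ _≡_ h → (∀ l → evalPoly cs (natR (h l)) ≈ evalPoly ds (natR (h l))) →
    ∀ y → evalPoly cs y ≈ evalPoly ds y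
  evalPoly-unique _ {zero} []      []      _  _  _ _ _ _ = refl
  evalPoly-unique _ {zero} (_ ∷ _) _       ()
  evalPoly-unique _ {zero} []      (_ ∷ _) _  ()
  evalPoly-unique isChar0Domain@(char , noZeroDivisors) {suc L} cs ds |cs|≤ |ds|≤ h h-inj agree y = begin
    evalPoly cs y                    ≈⟨ evalPoly-deflate z cs y ⟩
    (y - z) * Qc y + evalPoly cs z   ≈⟨ +-cong (*-congˡ (Q-agree y)) (agree 0) ⟩
    (y - z) * Qd y + evalPoly ds z   ≈⟨ evalPoly-deflate z ds y ⟨
    evalPoly ds y                    ∎
    where
    z = natR (h 0)
    Qc = evalPoly (deflate z cs)
    Qd = evalPoly (deflate z ds)
    deflate-≤ : ∀ cs → length cs ≤ suc L → length (deflate z cs) ≤ L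
    deflate-≤ cs |cs|≤ = ≡.subst (_≤ L) (≡.sym (length-deflate z cs)) (ℕ.pred-mono-≤ |cs|≤)
    Q-agree-next : ∀ l → Qc (natR (h (suc l))) ≈ Qd (natR (h (suc l)))
    Q-agree-next l = *-almostCancelˡ noZeroDivisors (yₗ - z) _ _ yₗ-z≉0 (∙-cancelʳ (evalPoly cs z) _ _ (begin
      (yₗ - z) * Qc yₗ + evalPoly cs z  ≈⟨ evalPoly-deflate z cs yₗ ⟨
      evalPoly cs yₗ                    ≈⟨ agree (suc l) ⟩
      evalPoly ds yₗ                    ≈⟨ evalPoly-deflate z ds yₗ ⟩
      (yₗ - z) * Qd yₗ + evalPoly ds z  ≈⟨ +-congˡ (agree 0) ⟨
      (yₗ - z) * Qd yₗ + evalPoly cs z  ∎))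
      where
      yₗ = natR (h (suc l))
      yₗ-z≉0 : ¬ (yₗ - z ≈ 0#)
      yₗ-z≉0 yₗ-z≈0 with () ← h-inj (natR-injective char _ _ (x∙y⁻¹≈ε⇒x≈y _ _ yₗ-z≈0))
    Q-agree : ∀ y → Qc y ≈ Qd y
    Q-agree = evalPoly-unique isChar0Domain (deflate z cs) (deflate z ds) (deflate-≤ cs |cs|≤) (deflate-≤ ds |ds|≤)
      (h ∘ suc) (ℕ.suc-injective ∘ h-inj) Q-agree-next

  polyFn-unique : IsChar0Domain → ∀ {p q} → IsPolyFn p → IsPolyFn q →
    ∀ h → Injective _≡_ _≡_ h → (∀ l → p (+ h l) ≈ q (+ h l)) → ∀ t → p t ≈ q t
  polyFn-unique isChar0Domain {p} {q} (cs , p≈cs) (ds , q≈ds) h h-inj agree t = begin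
    p t                    ≈⟨ p≈cs t ⟩
    evalPoly cs (intR t)   ≈⟨ evalPoly-unique isChar0Domain cs ds (ℕ.m≤m+n _ _) (ℕ.m≤n+m _ _) h h-inj cs≈ds (intR t) ⟩
    evalPoly ds (intR t)   ≈⟨ q≈ds t ⟨
    q t                    ∎
    where
    cs≈ds : ∀ l → evalPoly cs (natR (h l)) ≈ evalPoly ds (natR (h l))
    cs≈ds l = trans (sym (p≈cs (+ h l))) (trans (agree l) (q≈ds (+ h l)))

module QuasiPolynomial {c ℓ : Level} (R : CommutativeRing c ℓ) where
  open CommutativeRing R
  open QP R
  open Arithmetic using (gcd-*-coprime; gcd-rad∣gcd; prime∣gcd⇒∣gcd-rad; coprime-by-prime-factors; coprime-∣ʳ)
  open Congruence
  open Summation R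
  open Polynomial R
  open import Data.Nat.Base as ℕ using (suc; s≤s; z≤n)
  import Data.Nat.Properties as ℕ
  open import Data.Nat.Divisibility as ℕ using (_∣_; quotient)
  open import Data.Nat.Coprimality using (Coprime)
  open import Data.Nat.GCD using (gcd[m,n]∣n; gcd[m,n]≡0⇒m≡0)
  open import Data.Integer.Base as ℤ using (+_; _%ℕ_; 1ℤ)
  open import Data.Integer.Properties using (abs-*; pos-+; pos-*)
  open import Data.Integer.DivMod using (n%ℕd<d)
  open import Data.Integer.Divisibility.Signed using (divides)
  open import Data.Integer.Tactic.RingSolver using (solve-∀)
  open import Data.Product.Base using (_,_)
  open import Function.Base using (_∘_)
  import Relation.Binary.PropositionalEquality as ≡
  open import Relation.Binary.Reasoning.Setoid setoid

  -- Both constituents are polynomials agreeing with f at the infinitely many points ≡ x mod n·N.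
  constituents-agree : IsChar0Domain → ∀ {f n N cst g} .{{_ : NonZero n}} .{{_ : NonZero N}} →
    IsQPWith f n cst → IsQPWith f N g → ∀ x t → g (x %ℕ N) t ≈ cst (x %ℕ n) t
  constituents-agree isChar0Domain {f} {n} {N} {cst} {g} (cst-poly , f≈cst) (g-poly , f≈g) x =
    polyFn-unique isChar0Domain (g-poly _ (n%ℕd<d x N)) (cst-poly _ (n%ℕd<d x n)) sample sample-injective agree
    where
    M = n ℕ.* N
    instance _ = ℕ.m*n≢0 n N
    sample : ℕ → ℕ
    sample l = x %ℕ M ℕ.+ l ℕ.* M
    sample-injective : ∀ {l l'} → sample l ≡ sample l' → l ≡ l'
    sample-injective eq = ℕ.*-cancelʳ-≡ _ _ M (ℕ.+-cancelˡ-≡ (x %ℕ M) _ _ eq)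
    sample≡x : ∀ l → + sample l ≡ x [mod M ]
    sample≡x l = ≡[mod]-trans
      (≡[mod]-intro (+ l) (≡.trans (pos-+ (x %ℕ M) (l ℕ.* M)) (≡.cong (λ z → + (x %ℕ M) ℤ.+ z) (pos-* l M))))
      (≡[mod]-sym (≡[mod]-%ℕ M x))
    agree : ∀ l → g (x %ℕ N) (+ sample l) ≈ cst (x %ℕ n) (+ sample l)
    agree l = begin
      g (x %ℕ N) s    ≡⟨ ≡.cong (λ r → g r s) (≡[mod]⇒%ℕ≡ (≡[mod]-∣ (ℕ.n∣m*n n) (sample≡x l))) ⟨
      g (s %ℕ N) s    ≈⟨ f≈g s ⟨
      f s             ≈⟨ f≈cst s ⟩
      cst (s %ℕ n) s  ≡⟨ ≡.cong (λ r → cst r s) (≡[mod]⇒%ℕ≡ (≡[mod]-∣ (ℕ.m∣m*n N) (sample≡x l))) ⟩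
      cst (x %ℕ n) s  ∎
      where s = + sample l

  -- tildeConst N g invN d a t is definitionally invN * cosetSum N g a d t.
  cosetSum : (m : ℕ) → .{{NonZero m}} → (ℕ → ℤ → Carrier) → ℤ → ℕ → ℤ → Carrier
  cosetSum m cst a d t = sumTo m (λ i → cst ((a ℤ.- + i ℤ.* + d) %ℕ m) t)

  cosetSum-periodic : ∀ {m} .{{_ : NonZero m}} (cst : ℕ → ℤ → Carrier) a d t i →
    cst ((a ℤ.- + (m ℕ.+ i) ℤ.* + d) %ℕ m) t ≈ cst ((a ℤ.- + i ℤ.* + d) %ℕ m) t
  cosetSum-periodic {m} cst a d t i = reflexive (≡.cong (λ r → cst r t) (≡[mod]⇒%ℕ≡ (≡[mod]-step m a i (+ d))))

  cosetSum-change-period : IsChar0Domain → ∀ {f n N cst g} .{{_ : NonZero n}} .{{_ : NonZero N}} →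
    IsQPWith f n cst → IsQPWith f N g → ∀ a d t →
    natR n * cosetSum N g a d t ≈ natR N * cosetSum n cst a d t
  cosetSum-change-period isChar0Domain {n = n} {N} {cst} {g} n-qp N-qp a d t = begin
    natR n * sumTo N G   ≈⟨ sumTo-periodic n N G (cosetSum-periodic g a d t) ⟨
    sumTo (n ℕ.* N) G    ≈⟨ sumTo-cong (n ℕ.* N) (λ i → constituents-agree isChar0Domain n-qp N-qp (a ℤ.- + i ℤ.* + d) t) ⟩
    sumTo (n ℕ.* N) C    ≡⟨ ≡.cong (λ m → sumTo m C) (ℕ.*-comm n N) ⟩
    sumTo (N ℕ.* n) C    ≈⟨ sumTo-periodic N n C (cosetSum-periodic cst a d t) ⟩
    natR N * sumTo n C   ∎
    where
    G C : ℕ → Carrier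
    G i = g ((a ℤ.- + i ℤ.* + d) %ℕ N) t
    C i = cst ((a ℤ.- + i ℤ.* + d) %ℕ n) t

  module GcdConstituents (n : ℕ) .{{_ : NonZero n}} (cst : ℕ → ℤ → Carrier) (gcd-property : GcdProperty n cst) (t : ℤ) where

    value : ℤ → Carrier
    value x = cst (x %ℕ n) t

    value-resp : ∀ {x y} → x ≡ y [mod n ] → value x ≈ value y
    value-resp x≡y = reflexive (≡.cong (λ r → cst r t) (≡[mod]⇒%ℕ≡ x≡y))

    value-gcd : ∀ x → value x ≈ value (+ gcd ∣ x ∣ n)
    value-gcd x = begin
      value x                  ≈⟨ value-resp r≡x ⟨
      cst (+ r %ℕ n) t         ≈⟨ gcd-property r (s≤s z≤n) (n%ℕd<d (x ℤ.- 1ℤ) n) t ⟩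
      cst (+ gcd r n %ℕ n) t   ≡⟨ ≡.cong (λ m → cst (+ m %ℕ n) t) (≡[mod]-gcd r≡x) ⟩
      value (+ gcd ∣ x ∣ n)    ∎
      where
      -- the representative of x in {1, …, n}, where the gcd-property applies
      r = suc ((x ℤ.- 1ℤ) %ℕ n)
      1+[x-1] : ∀ x → 1ℤ ℤ.+ (x ℤ.- 1ℤ) ≡ x
      1+[x-1] = solve-∀
      r≡x : + r ≡ x [mod n ]
      r≡x = ≡[mod]-trans (≡[mod]-+ˡ 1ℤ (≡[mod]-sym (≡[mod]-%ℕ n (x ℤ.- 1ℤ)))) (≡[mod]-reflexive (1+[x-1] x))

    value-unit : ∀ {u} x → Coprime u n → value (+ u ℤ.* x) ≈ value x
    value-unit {u} x u⊥n = begin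
      value (+ u ℤ.* x)               ≈⟨ value-gcd (+ u ℤ.* x) ⟩
      value (+ gcd ∣ + u ℤ.* x ∣ n)   ≡⟨ ≡.cong (λ m → value (+ gcd m n)) (abs-* (+ u) x) ⟩
      value (+ gcd (u ℕ.* ∣ x ∣) n)   ≡⟨ ≡.cong (λ m → value (+ m)) (gcd-*-coprime ∣ x ∣ u⊥n) ⟩
      value (+ gcd ∣ x ∣ n)           ≈⟨ value-gcd x ⟨
      value x                         ∎

    cosetSum-multiplier : ∀ {d} a a' {u q} → Coprime u n → + u ℤ.* a ℤ.- a' ≡ q ℤ.* + d →
      cosetSum n cst a d t ≈ cosetSum n cst a' d t
    cosetSum-multiplier {d} a a' {u} {q} u⊥n ua-a'≡qd = begin
      sumTo n (λ i → value (a ℤ.- + i ℤ.* + d))            ≈⟨ sumTo-cong n (λ i → value-unit _ u⊥n) ⟨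
      sumTo n (λ i → value (+ u ℤ.* (a ℤ.- + i ℤ.* + d)))  ≈⟨ sumTo-cong n (λ i → reflexive (≡.cong value (affine-coset {+ u} {a} {a'} {q} {+ d} ua-a'≡qd (+ i)))) ⟩
      sumTo n (λ i → G (+ u ℤ.* + i ℤ.+ ℤ.- q))            ≈⟨ sumTo-affine n G G-resp (+ u) u⊥n (ℤ.- q) ⟨
      sumTo n (λ i → G (+ i))                              ∎
      where
      G : ℤ → Carrier
      G y = value (a' ℤ.- y ℤ.* + d)
      G-resp : ∀ {x y} → x ≡ y [mod n ] → G x ≈ G y
      G-resp x≡y = value-resp (≡[mod]-+ˡ a' (≡[mod]-neg (≡[mod]-*ʳ (+ d) x≡y)))

    cosetSum-unit : ∀ {d} a a' .{{_ : NonZero d}} → d ∣ n → Coprime ∣ a ∣ n → Coprime ∣ a' ∣ d →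
      cosetSum n cst a d t ≈ cosetSum n cst a' d t
    cosetSum-unit {d} a a' d∣n a⊥n a'⊥d =
      let u , u⊥n , mod-∣ (divides q ua-a'≡qd) = unit-multiplier a a' d∣n a⊥n a'⊥d
      in cosetSum-multiplier {d} a a' {u} {q} u⊥n ua-a'≡qd

    cosetSum-interleave : ∀ w a e →
      natR w * cosetSum n cst a e t ≈ sumTo w (λ b → cosetSum n cst (a ℤ.- + b ℤ.* + e) (w ℕ.* e) t)
    cosetSum-interleave w a e = trans (sumTo-interleave w n _ (cosetSum-periodic cst a e t))
      (sumTo-cong w (λ b → sumTo-cong n (λ i → reflexive (≡.cong value (index≡ i b)))))
      where
      regroup : ∀ a i w b e → a ℤ.- (i ℤ.* w ℤ.+ b) ℤ.* e ≡ (a ℤ.- b ℤ.* e) ℤ.- i ℤ.* (w ℤ.* e)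
      regroup = solve-∀
      index≡ : ∀ i b → a ℤ.- + (i ℕ.* w ℕ.+ b) ℤ.* + e ≡ (a ℤ.- + b ℤ.* + e) ℤ.- + i ℤ.* + (w ℕ.* e)
      index≡ i b = ≡.trans (≡.cong (λ m → a ℤ.- m ℤ.* + e) (≡.trans (pos-+ (i ℕ.* w) b) (≡.cong (λ z → z ℤ.+ + b) (pos-* i w))))
        (≡.trans (regroup a (+ i) (+ w) (+ b) (+ e)) (≡.cong (λ m → (a ℤ.- + b ℤ.* + e) ℤ.- + i ℤ.* m) (≡.sym (pos-* w e))))

    cosetSum-gcd-rad : IsChar0Domain → ∀ k .{{_ : NonZero k}} a → Coprime ∣ a ∣ n →
      cosetSum n cst a (gcd k n) t ≈ cosetSum n cst a (gcd k (rad n)) t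
    cosetSum-gcd-rad isChar0Domain k a a⊥n = natR-cancelˡ isChar0Domain w (begin
      natR w * S d₁                                                    ≈⟨ sumTo-const w (S d₁) ⟨
      sumTo w (λ _ → S d₁)                                             ≈⟨ sumTo-cong w (λ b → cosetSum-unit a (a ℤ.- + b ℤ.* + d₂) (gcd[m,n]∣n k n) a⊥n (shifted⊥d₁ b)) ⟩
      sumTo w (λ b → cosetSum n cst (a ℤ.- + b ℤ.* + d₂) d₁ t)          ≡⟨ ≡.cong (λ e → sumTo w (λ b → cosetSum n cst (a ℤ.- + b ℤ.* + d₂) e t)) d₁≡wd₂ ⟩
      sumTo w (λ b → cosetSum n cst (a ℤ.- + b ℤ.* + d₂) (w ℕ.* d₂) t)  ≈⟨ cosetSum-interleave w a d₂ ⟨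
      natR w * S d₂                                                    ∎)
      where
      S : ℕ → Carrier
      S e = cosetSum n cst a e t
      d₁ = gcd k n
      d₂ = gcd k (rad n)
      d₂∣d₁ = gcd-rad∣gcd k n
      w = quotient d₂∣d₁
      d₁≡wd₂ : d₁ ≡ w ℕ.* d₂
      d₁≡wd₂ = ℕ._∣_.equality d₂∣d₁
      instance
        _ = ℕ.≢-nonZero (ℕ.≢-nonZero⁻¹ k ∘ gcd[m,n]≡0⇒m≡0)
        _ = ℕ.quotient≢0 d₂∣d₁
      shifted⊥d₁ : ∀ b → Coprime ∣ a ℤ.- + b ℤ.* + d₂ ∣ d₁
      shifted⊥d₁ b = coprime-by-prime-factors (prime∣gcd⇒∣gcd-rad k n)
        (≡[mod]-coprime (≡[mod]-sym (≡[mod]-sub-multiple d₂ a (+ b)))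
          (coprime-∣ʳ (ℕ.∣-trans d₂∣d₁ (gcd[m,n]∣n k n)) a⊥n))

proposition2p12 : ∀ {c ℓ : Level} (R : CommutativeRing c ℓ) →
    let open CommutativeRing R in let open QP R in
    IsChar0Domain →
    (f : ℤ → Carrier) →
    (n : ℕ) → .{{_ : NonZero n}} → (cst : ℕ → ℤ → Carrier) →
    IsQPWith f n cst → GcdProperty n cst →
    (N : ℕ) → .{{_ : NonZero N}} → (g : ℕ → ℤ → Carrier) →
    IsQPWith f N g → (∀ M → 0 < M → M < N → ¬ IsPeriod f M) →
    (invN : Carrier) → invN * natR N ≈ 1# →
    (k : ℕ) → .{{_ : NonZero k}} →
    (j : ℤ) → gcd ∣ j ∣ n ≡ 1 →
    ∀ t → tildeConst N g invN (gcd k n) j t ≈ tildeConst N g invN (gcd k (rad n)) j t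
proposition2p12 R isChar0Domain f n cst n-qp gcd-property N g N-qp _ invN _ k j j⊥n t =
  *-congˡ (natR-cancelˡ isChar0Domain n (begin
    natR n * cosetSum N g j d₁ t     ≈⟨ cosetSum-change-period isChar0Domain n-qp N-qp j d₁ t ⟩
    natR N * cosetSum n cst j d₁ t   ≈⟨ *-congˡ (cosetSum-gcd-rad isChar0Domain k j (gcd≡1⇒coprime j⊥n)) ⟩
    natR N * cosetSum n cst j d₂ t   ≈⟨ cosetSum-change-period isChar0Domain n-qp N-qp j d₂ t ⟨
    natR n * cosetSum N g j d₂ t     ∎))
  where
  open CommutativeRing R
  open QP R
  open Polynomial R using (natR-cancelˡ)
  open QuasiPolynomial R
  open GcdConstituents n cst gcd-property t
  open import Relation.Binary.Reasoning.Setoid setoid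
  d₁ = gcd k n
  d₂ = gcd k (rad n)
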